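{- Let $G$ be a tree and $\Delta\in\mathbb{N}$. Then every labeling produced by the radius algorithm on $(G,\Delta)$ has stretch at most $\frac{\Delta+1}{2}$.
   Context: A $\Delta$-periodic labeling of $G=(V,E)$ is a function $\lambda:E\to\{1,\dots,\Delta\}$; edge $e$ is available exactly at times $\lambda(e)+i\Delta$, $i\ge0$. A temporal path from $s$ to $z$ is a path $s=v_0,\dots,v_k=z$ with distinct vertices and times $t_1<\dots<t_k$ with $\{v_{i-1},v_i\}$ available at $t_i$; its duration is $t_k-t_1+1$. The stretch of $\lambda$ is the maximum over ordered pairs of distinct vertices $(u,v)$ of (minimum duration of a temporal path from $u$ to $v$)$/\operatorname{dist}_G(u,v)$. The radius algorithm: choose a vertex $v_x$ of eccentricity equal to the radius $\mathrm{rad}$; for each $i\in\{1,\dots,\mathrm{rad}\}$, give every edge joining a vertex at distance $i-1$ from $v_x$ to a vertex at distance $i$ from $v_x$ the label $\lceil\Delta/2\rceil$ if $i$ is odd and $\Delta$ if $i$ is even; label all other edges arbitrarily. -}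

module Defs where

open import Data.Nat using (ℕ; zero; suc; _+_; _*_; _∸_; _≤_; _<_; ⌈_/2⌉; _%_)
open import Data.Fin using (Fin)
open import Data.List using (List; []; _∷_)
open import Data.List.Relation.Unary.Unique.Propositional using (Unique)
open import Data.Product using (Σ; ∃; _×_; _,_)
open import Relation.Binary.PropositionalEquality using (_≡_)
open import Relation.Nullary using (¬_)
open import Level using (Level; 0ℓ)

record Graph : Set₁ where
  field
    n      : ℕ
    Adj    : Fin n → Fin n → Set
    sym    : ∀ {u v} → Adj u v → Adj v u
    irrefl : ∀ {u} → ¬ Adj u u

module _ (G : Graph) where
  open Graph G

  data Walk : Fin n → Fin n → ℕ → Set where
    stop : ∀ {u} → Walk u u zero
    step : ∀ {u w v k} → Adj u w → Walk w v k → Walk u v (suc k)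

  walkVerts : ∀ {u v k} → Walk u v k → List (Fin n)
  walkVerts (stop {u}) = u ∷ []
  walkVerts (step {u} _ w) = u ∷ walkVerts w

  Path : Fin n → Fin n → ℕ → Set
  Path u v k = Σ (Walk u v k) (λ w → Unique (walkVerts w))

  Connected : Set
  Connected = ∀ u v → ∃ λ k → Path u v k

  -- A cycle: a path u … w with ≥ 2 edges, closed by the edge {w,u}.
  Acyclic : Set
  Acyclic = ¬ (Σ (Fin n) λ u → Σ (Fin n) λ w → Σ ℕ λ k →
                 Path u w k × Adj w u × 2 ≤ k)

  IsTree : Set
  IsTree = Connected × Acyclic

  IsDist : Fin n → Fin n → ℕ → Set
  IsDist u v d = Path u v d × (∀ k → Path u v k → d ≤ k)

  IsEcc : Fin n → ℕ → Set
  IsEcc v e = (∀ u d → IsDist v u d → d ≤ e) × (∃ λ u → IsDist v u e)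

  IsRadius : ℕ → Set
  IsRadius r = (∃ λ v → IsEcc v r) × (∀ v e → IsEcc v e → r ≤ e)

  -- Δ-periodic labeling: symmetric on edges, values in {1,…,Δ} on edges.
  -- (Values on non-edges are irrelevant.)
  IsLabeling : ℕ → (Fin n → Fin n → ℕ) → Set
  IsLabeling Δ lab = ∀ {u v} → Adj u v → (lab u v ≡ lab v u) × (1 ≤ lab u v) × (lab u v ≤ Δ)

  Avail : ℕ → ℕ → ℕ → Set
  Avail Δ l t = ∃ λ j → t ≡ l + j * Δ

  data TWalk (Δ : ℕ) (lab : Fin n → Fin n → ℕ) : Fin n → Fin n → ℕ → ℕ → Set where
    last : ∀ {u v t} → Adj u v → Avail Δ (lab u v) t → TWalk Δ lab u v t t
    cons : ∀ {u w v t t' tk} → Adj u w → Avail Δ (lab u w) t → t < t' →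
           TWalk Δ lab w v t' tk → TWalk Δ lab u v t tk

  twVerts : ∀ {Δ lab u v t tk} → TWalk Δ lab u v t tk → List (Fin n)
  twVerts (last {u} {v} _ _) = u ∷ v ∷ []
  twVerts (cons {u} _ _ _ w) = u ∷ twVerts w

  TPath : ℕ → (Fin n → Fin n → ℕ) → Fin n → Fin n → ℕ → ℕ → Set
  TPath Δ lab u v t tk = Σ (TWalk Δ lab u v t tk) (λ w → Unique (twVerts w))

  duration : ℕ → ℕ → ℕ
  duration t₁ tₖ = suc (tₖ ∸ t₁)

  -- stretch(lab) ≤ (Δ+1)/2: for every ordered pair of distinct vertices u,v,
  -- some temporal path from u to v has duration D with D / dist(u,v) ≤ (Δ+1)/2,
  -- i.e. 2·D ≤ (Δ+1)·dist(u,v).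
  StretchAtMostHalfΔ+1 : ℕ → (Fin n → Fin n → ℕ) → Set
  StretchAtMostHalfΔ+1 Δ lab = ∀ u v → ¬ u ≡ v → ∀ d → IsDist u v d →
    ∃ λ t₁ → ∃ λ tₖ → TPath Δ lab u v t₁ tₖ × 2 * duration t₁ tₖ ≤ (Δ + 1) * d

  RadiusAlgorithmLabeling : ℕ → (Fin n → Fin n → ℕ) → Set
  RadiusAlgorithmLabeling Δ lab =
    IsLabeling Δ lab ×
    (Σ (Fin n) λ vx → Σ ℕ λ rad → IsRadius rad × IsEcc vx rad ×
      (∀ a b i → Adj a b → IsDist vx a i → IsDist vx b (suc i) → suc i ≤ rad →
        (suc i % 2 ≡ 1 → lab a b ≡ ⌈ Δ /2⌉) × (suc i % 2 ≡ 0 → lab a b ≡ Δ)))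

-- Root the tree at the centre vx. Every edge joins consecutive depths, and the radius
-- algorithm labels the edge entering depth d by the parity of d, so along any run of edges
-- heading towards the root, or away from it, the labels alternate between ⌈Δ/2⌉ and Δ and
-- each wait is at most ⌈Δ/2⌉ ≤ (Δ+1)/2. Since every vertex has a single parent, a tree path
-- first descends towards the root and then ascends; only at the turning vertex do two
-- consecutive edges carry the same label, costing a wait of up to Δ. The first edge of the
-- path contributes 1 instead of (Δ+1)/2 to the duration, and this slack pays for the turn.
module Submission where

open import Defs
open import Data.Nat using (ℕ; zero; suc; _+_; _*_; _∸_; _≤_; _<_; z≤n; s≤s; ⌊_/2⌋; ⌈_/2⌉; _%_)
open import Data.Nat.Properties
  using ( +-comm; +-assoc; +-identityʳ; +-mono-≤; +-monoˡ-≤; +-monoʳ-≤; +-cancelˡ-≤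
        ; *-distribˡ-+; *-monoʳ-≤; ≤-refl; ≤-reflexive; ≤-trans; ≤-<-trans; <⇒≤; ≮⇒≥; _<?_
        ; m≤m+n; m<n+m; m∸n≤m; m∸n+n≡m; m+[n∸m]≡n; m<n⇒0<n∸m; m≤n+o⇒m∸n≤o; m≤n⇒m<n∨m≡n
        ; ⌊n/2⌋≤⌈n/2⌉; ⌊n/2⌋+⌈n/2⌉≡n; ⌈n/2⌉≤n; ⌈n/2⌉-mono; module ≤-Reasoning )
open import Data.Nat.Tactic.RingSolver using (solve-∀)
open import Data.Fin using (Fin; _≟_)
open import Data.List using (List; []; _∷_; _++_; _∷ʳ_; [_]; length)
open import Data.List.Properties using (length-++; ∷ʳ-injectiveˡ)
open import Data.List.Membership.Propositional using (_∈_; _∉_)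
open import Data.List.Relation.Unary.Any using (here; there)
open import Data.List.Relation.Unary.All using ([]; _∷_)
import Data.List.Relation.Unary.All as All
open import Data.List.Relation.Unary.All.Properties using (¬Any⇒All¬; All¬⇒¬Any; ++⁻ˡ)
open import Data.List.Relation.Unary.AllPairs using ([]; _∷_)
open import Data.List.Relation.Unary.Unique.Propositional using (Unique)
open import Data.List.Relation.Unary.Unique.Propositional.Properties using (++⁺; Unique[x∷xs]⇒x∉xs)
open import Data.Product using (Σ; ∃; ∃₂; _×_; _,_; proj₁; proj₂)
open import Data.Sum using (_⊎_; inj₁; inj₂)
open import Data.Empty using (⊥; ⊥-elim)
open import Relation.Nullary using (yes; no)
open import Relation.Binary.PropositionalEquality
  using (_≡_; _≢_; refl; sym; trans; cong; cong₂; subst; module ≡-Reasoning)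

2*⌈n/2⌉≤1+n : ∀ m → 2 * ⌈ m /2⌉ ≤ suc m
2*⌈n/2⌉≤1+n m = begin
  2 * ⌈ m /2⌉               ≡⟨ cong (⌈ m /2⌉ +_) (+-identityʳ ⌈ m /2⌉) ⟩
  ⌊ suc m /2⌋ + ⌊ suc m /2⌋ ≤⟨ +-monoʳ-≤ ⌊ suc m /2⌋ (⌊n/2⌋≤⌈n/2⌉ (suc m)) ⟩
  ⌊ suc m /2⌋ + ⌈ suc m /2⌉ ≡⟨ ⌊n/2⌋+⌈n/2⌉≡n (suc m) ⟩
  suc m                     ∎
  where open ≤-Reasoning

n∸⌈n/2⌉≤⌈n/2⌉ : ∀ m → m ∸ ⌈ m /2⌉ ≤ ⌈ m /2⌉
n∸⌈n/2⌉≤⌈n/2⌉ m = m≤n+o⇒m∸n≤o m ⌈ m /2⌉ (begin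
  m                     ≡⟨ ⌊n/2⌋+⌈n/2⌉≡n m ⟨
  ⌊ m /2⌋ + ⌈ m /2⌉     ≤⟨ +-monoˡ-≤ ⌈ m /2⌉ (⌊n/2⌋≤⌈n/2⌉ m) ⟩
  ⌈ m /2⌉ + ⌈ m /2⌉     ∎)
  where open ≤-Reasoning

-- Time bounds are doubled, so that the share (Δ+1)/2 of each edge is an integer.
module DoubledTime (Δ : ℕ) where

  wait-≤-half-period : ∀ t m {t' c} → t' ≤ ⌈ Δ /2⌉ + t →
                       c ≤ 2 * t' + m * suc Δ → c ≤ 2 * t + suc m * suc Δ
  wait-≤-half-period t m {t'} {c} t'≤ c≤ = begin
    c                               ≤⟨ c≤ ⟩
    2 * t' + m * suc Δ              ≤⟨ +-monoˡ-≤ (m * suc Δ) (*-monoʳ-≤ 2 t'≤) ⟩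
    2 * (⌈ Δ /2⌉ + t) + m * suc Δ   ≡⟨ cong (_+ m * suc Δ) (*-distribˡ-+ 2 ⌈ Δ /2⌉ t) ⟩
    2 * ⌈ Δ /2⌉ + 2 * t + m * suc Δ ≤⟨ +-monoˡ-≤ (m * suc Δ) (+-monoˡ-≤ (2 * t) (2*⌈n/2⌉≤1+n Δ)) ⟩
    suc Δ + 2 * t + m * suc Δ       ≡⟨ rearrange Δ t m ⟩
    2 * t + suc m * suc Δ           ∎
    where
      open ≤-Reasoning
      rearrange : ∀ Δ t m → suc Δ + 2 * t + m * suc Δ ≡ 2 * t + suc m * suc Δ
      rearrange = solve-∀

  wait-≤-period : ∀ t m {t' c} → t' ≤ Δ + t →
                  c ≤ 2 * t' + m * suc Δ → c + 2 ≤ 2 * t + suc (suc m) * suc Δ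
  wait-≤-period t m {t'} {c} t'≤ c≤ = begin
    c + 2                       ≤⟨ +-monoˡ-≤ 2 c≤ ⟩
    2 * t' + m * suc Δ + 2      ≤⟨ +-monoˡ-≤ 2 (+-monoˡ-≤ (m * suc Δ) (*-monoʳ-≤ 2 t'≤)) ⟩
    2 * (Δ + t) + m * suc Δ + 2 ≡⟨ rearrange Δ t m ⟩
    2 * t + suc (suc m) * suc Δ ∎
    where
      open ≤-Reasoning
      rearrange : ∀ Δ t m → 2 * (Δ + t) + m * suc Δ + 2 ≡ 2 * t + suc (suc m) * suc Δ
      rearrange = solve-∀

  first-edge-slack : ∀ t m {c} → 1 ≤ Δ → c ≤ 2 * t + m * suc Δ → c + 2 ≤ 2 * t + suc m * suc Δ
  first-edge-slack t m {c} 1≤Δ c≤ = begin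
    c + 2                      ≤⟨ +-mono-≤ c≤ (s≤s 1≤Δ) ⟩
    2 * t + m * suc Δ + suc Δ  ≡⟨ rearrange Δ t m ⟩
    2 * t + suc m * suc Δ      ∎
    where
      open ≤-Reasoning
      rearrange : ∀ Δ t m → 2 * t + m * suc Δ + suc Δ ≡ 2 * t + suc m * suc Δ
      rearrange = solve-∀

  doubled-duration : ∀ {t tₖ} k → t ≤ tₖ → 2 * tₖ + 2 ≤ 2 * t + suc k * suc Δ →
                     2 * suc (tₖ ∸ t) ≤ (Δ + 1) * suc k
  doubled-duration {t} {tₖ} k t≤tₖ bound = +-cancelˡ-≤ (2 * t) _ _ (begin
    2 * t + 2 * suc (tₖ ∸ t)   ≡⟨ expand t (tₖ ∸ t) ⟩
    2 * (t + (tₖ ∸ t)) + 2     ≡⟨ cong (λ s → 2 * s + 2) (m+[n∸m]≡n t≤tₖ) ⟩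
    2 * tₖ + 2                 ≤⟨ bound ⟩
    2 * t + suc k * suc Δ      ≡⟨ cong (2 * t +_) (commute k Δ) ⟩
    2 * t + (Δ + 1) * suc k    ∎)
    where
      open ≤-Reasoning
      expand : ∀ t s → 2 * t + 2 * suc s ≡ 2 * (t + s) + 2
      expand = solve-∀
      commute : ∀ k Δ → suc k * suc Δ ≡ (Δ + 1) * suc k
      commute = solve-∀

-- The label that the radius algorithm gives to edges entering depth d.
levelLabel : ℕ → ℕ → ℕ
levelLabel Δ zero          = Δ
levelLabel Δ (suc zero)    = ⌈ Δ /2⌉
levelLabel Δ (suc (suc d)) = levelLabel Δ d

levelLabel-by-parity : ∀ Δ d {l} → (d % 2 ≡ 1 → l ≡ ⌈ Δ /2⌉) × (d % 2 ≡ 0 → l ≡ Δ) →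
                       l ≡ levelLabel Δ d
levelLabel-by-parity Δ zero          (_ , even) = even refl
levelLabel-by-parity Δ (suc zero)    (odd , _)  = odd refl
levelLabel-by-parity Δ (suc (suc d)) rule       = levelLabel-by-parity Δ d rule

module _ (G : Graph) where
  open Graph G renaming (sym to Adj-sym)
  open import Data.List.Membership.DecPropositional (_≟_ {n}) using (_∈?_)

  data Trail : Fin n → List (Fin n) → Fin n → Set where
    []  : ∀ {a} → Trail a [] a
    _∷_ : ∀ {a b c xs} → Adj a b → Trail b xs c → Trail a (b ∷ xs) c

  _++ᵗ_ : ∀ {a b c xs ys} → Trail a xs b → Trail b ys c → Trail a (xs ++ ys) c
  []      ++ᵗ t = t
  (e ∷ s) ++ᵗ t = e ∷ (s ++ᵗ t)

  end∈ : ∀ {a b xs} → Trail a xs b → b ∈ a ∷ xs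
  end∈ []      = here refl
  end∈ (_ ∷ t) = there (end∈ t)

  end-unique : ∀ {a b c xs} → Trail a xs b → Trail a xs c → b ≡ c
  end-unique []      []      = refl
  end-unique (_ ∷ s) (_ ∷ t) = end-unique s t

  splitAt : ∀ {a c m xs} → Trail a xs c → Unique (a ∷ xs) → m ∈ a ∷ xs →
            ∃₂ λ ys zs → xs ≡ ys ++ zs × (Trail a ys m × Unique (a ∷ ys))
                                       × (Trail m zs c × Unique (m ∷ zs))
  splitAt t u (here refl) = [] , _ , refl , ([] , [] ∷ []) , (t , u)
  splitAt (e ∷ t) (a∉ ∷ u) (there m∈) with splitAt t u m∈
  ... | ys , zs , refl , (s , us) , rest =
    _ ∷ ys , zs , refl , (e ∷ s , ++⁻ˡ (_ ∷ ys) a∉ ∷ us) , rest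

  inner : ∀ {a b k} → Walk G a b k → List (Fin n)
  inner stop              = []
  inner (step {w = w} _ p) = w ∷ inner p

  toTrail : ∀ {a b k} (p : Walk G a b k) → Trail a (inner p) b
  toTrail stop       = []
  toTrail (step e p) = e ∷ toTrail p

  walkVerts≡∷inner : ∀ {a b k} (p : Walk G a b k) → walkVerts G p ≡ a ∷ inner p
  walkVerts≡∷inner stop           = refl
  walkVerts≡∷inner {a} (step _ p) = cong (a ∷_) (walkVerts≡∷inner p)

  length-inner : ∀ {a b k} (p : Walk G a b k) → length (inner p) ≡ k
  length-inner stop       = refl
  length-inner (step _ p) = cong suc (length-inner p)

  inner-unique : ∀ {a b k} ((p , _) : Path G a b k) → Unique (a ∷ inner p)
  inner-unique (p , u) = subst Unique (walkVerts≡∷inner p) u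

  toWalk : ∀ {a b xs} → Trail a xs b → Walk G a b (length xs)
  toWalk []      = stop
  toWalk (e ∷ t) = step e (toWalk t)

  walkVerts-toWalk : ∀ {a b xs} (t : Trail a xs b) → walkVerts G (toWalk t) ≡ a ∷ xs
  walkVerts-toWalk []          = refl
  walkVerts-toWalk {a} (_ ∷ t) = cong (a ∷_) (walkVerts-toWalk t)

  start∈walkVerts : ∀ {a b k} (p : Walk G a b k) → a ∈ walkVerts G p
  start∈walkVerts stop       = here refl
  start∈walkVerts (step _ _) = here refl

  departure≤arrival : ∀ {Δ lab u v t tₖ} → TWalk G Δ lab u v t tₖ → t ≤ tₖ
  departure≤arrival (last _ _)         = ≤-refl
  departure≤arrival (cons _ _ t<t' tw) = ≤-trans (<⇒≤ t<t') (departure≤arrival tw)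

  module _ (acyclic : Acyclic G) where

    no-closing-edge : ∀ {a b xs} → Trail a xs b → Unique (a ∷ xs) → Adj b a → 2 ≤ length xs → ⊥
    no-closing-edge t u ba 2≤ =
      acyclic (_ , _ , _ , (toWalk t , subst Unique (sym (walkVerts-toWalk t)) u) , ba , 2≤)

    no-chord-from-start : ∀ {x l m e p} → Trail x (l ∷ p) e → Unique (x ∷ l ∷ p) →
                          Adj x m → l ≢ m → m ∉ l ∷ p
    no-chord-from-start t u xm l≢m m∈ with splitAt t u (there m∈)
    ... | []        , _ , _    , ([] , _)     , _ = irrefl xm
    ... | _ ∷ []    , _ , refl , (_ ∷ [] , _) , _ = l≢m refl
    ... | _ ∷ _ ∷ _ , _ , _    , (s , us)     , _ =
      no-closing-edge s us (Adj-sym xm) (s≤s (s≤s z≤n))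

    -- Follow the second path from m: while it stays off the first path, prepend each of its
    -- vertices to the first path. Where the two paths meet, the met vertex is a chord.
    no-reconvergence : ∀ {x l m e p q} → Trail x (l ∷ p) e → Unique (x ∷ l ∷ p) →
                       Trail m q e → Unique (m ∷ q) → x ∉ q → Adj x m → l ≢ m → ⊥
    no-reconvergence tp@(_ ∷ tl) up [] _ _ xm l≢m = no-chord-from-start tp up xm l≢m (end∈ tl)
    no-reconvergence {x} {l} {m} {p = p} tp up (mm' ∷ tq) (m≢q ∷ uq) x∉ xm l≢m =
      no-reconvergence (Adj-sym xm ∷ tp) (¬Any⇒All¬ _ m∉xlp ∷ up) tq uq
                       (All¬⇒¬Any (All.tail m≢q)) mm' (λ x≡m' → x∉ (here x≡m'))
      where
        m∉xlp : m ∉ x ∷ l ∷ p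
        m∉xlp (here refl) = irrefl xm
        m∉xlp (there m∈)  = no-chord-from-start tp up xm l≢m m∈

    trail-unique : ∀ {x e xs ys} → Trail x xs e → Unique (x ∷ xs) →
                   Trail x ys e → Unique (x ∷ ys) → xs ≡ ys
    trail-unique []       _  []       _  = refl
    trail-unique []       _  (_ ∷ t)  uy = ⊥-elim (Unique[x∷xs]⇒x∉xs uy (end∈ t))
    trail-unique (_ ∷ s)  ux []       _  = ⊥-elim (Unique[x∷xs]⇒x∉xs ux (end∈ s))
    trail-unique {xs = l ∷ _} {m ∷ _} (xl ∷ s) ux@(_ ∷ ul) (xm ∷ t) uy@(_ ∷ um) with l ≟ m
    ... | yes refl = cong (l ∷_) (trail-unique s ul t um)
    ... | no l≢m   = ⊥-elim (no-reconvergence (xl ∷ s) ux t um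
                                              (λ x∈ → Unique[x∷xs]⇒x∉xs uy (there x∈)) xm l≢m)

  module Timetable (Δ : ℕ) where

    DepartureWithin : ℕ → ℕ → ℕ → Set
    DepartureWithin w l t = ∃ λ t' → t < t' × Avail G Δ l t' × t' ≤ w + t

    departs-at-label : ∀ {l} → Avail G Δ l l
    departs-at-label {l} = 0 , sym (+-identityʳ l)

    widen : ∀ {w w' l t} → w ≤ w' → DepartureWithin w l t → DepartureWithin w' l t
    widen w≤w' (t' , t<t' , av , t'≤) = t' , t<t' , av , ≤-trans t'≤ (+-monoˡ-≤ _ w≤w')

    avail-shift : ∀ s {l t} → Avail G Δ l t → Avail G Δ (s + l) (s + t)
    avail-shift s {l} (j , refl) = j , sym (+-assoc s l (j * Δ))

    avail-period : ∀ {l t} → Avail G Δ (l + Δ) t → Avail G Δ l t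
    avail-period {l} (j , refl) = suc j , +-assoc l Δ (j * Δ)

    later-departure : ∀ {l l' t} → l < l' → Avail G Δ l t → DepartureWithin (l' ∸ l) l' t
    later-departure {l} {l'} {t} l<l' av =
      l' ∸ l + t , m<n+m t (m<n⇒0<n∸m l<l') ,
      subst (λ k → Avail G Δ k (l' ∸ l + t)) (m∸n+n≡m (<⇒≤ l<l')) (avail-shift (l' ∸ l) av) , ≤-refl

    next-period-departure : ∀ {l l' t} → l < l' + Δ → Avail G Δ l t →
                            DepartureWithin (l' + Δ ∸ l) l' t
    next-period-departure l<l'+Δ av with later-departure l<l'+Δ av
    ... | t' , t<t' , av' , t'≤ = t' , t<t' , avail-period av' , t'≤

    departure-within-period : ∀ {l l' t} → l ≤ Δ → 1 ≤ l' → l' ≤ Δ → Avail G Δ l t →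
                              DepartureWithin Δ l' t
    departure-within-period {l} {l'} l≤Δ 1≤l' l'≤Δ av with l <? l'
    ... | yes l<l' = widen (≤-trans (m∸n≤m l' l) l'≤Δ) (later-departure l<l' av)
    ... | no l≮l'  = widen (m≤n+o⇒m∸n≤o (l' + Δ) l (+-monoˡ-≤ Δ (≮⇒≥ l≮l')))
                           (next-period-departure (≤-<-trans l≤Δ (m<n+m Δ 1≤l')) av)

    departure-Δ→⌈Δ/2⌉ : ∀ {t} → 1 ≤ Δ → Avail G Δ Δ t → DepartureWithin ⌈ Δ /2⌉ ⌈ Δ /2⌉ t
    departure-Δ→⌈Δ/2⌉ {t} 1≤Δ av =
      ⌈ Δ /2⌉ + t , m<n+m t (⌈n/2⌉-mono 1≤Δ) , avail-period (avail-shift ⌈ Δ /2⌉ av) , ≤-refl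

    departure-⌈Δ/2⌉→Δ : ∀ {t} → 1 ≤ Δ → Avail G Δ ⌈ Δ /2⌉ t → DepartureWithin ⌈ Δ /2⌉ Δ t
    departure-⌈Δ/2⌉→Δ {t} 1≤Δ av with m≤n⇒m<n∨m≡n (⌈n/2⌉≤n Δ)
    ... | inj₁ ⌈Δ/2⌉<Δ = widen (n∸⌈n/2⌉≤⌈n/2⌉ Δ) (later-departure ⌈Δ/2⌉<Δ av)
    ... | inj₂ ⌈Δ/2⌉≡Δ = subst (λ l → DepartureWithin ⌈ Δ /2⌉ l t) ⌈Δ/2⌉≡Δ
                           (departure-Δ→⌈Δ/2⌉ 1≤Δ (subst (λ l → Avail G Δ l t) ⌈Δ/2⌉≡Δ av))

    departure-next-level : 1 ≤ Δ → ∀ d {t} → Avail G Δ (levelLabel Δ d) t →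
                           DepartureWithin ⌈ Δ /2⌉ (levelLabel Δ (suc d)) t
    departure-next-level 1≤Δ zero          = departure-Δ→⌈Δ/2⌉ 1≤Δ
    departure-next-level 1≤Δ (suc zero)    = departure-⌈Δ/2⌉→Δ 1≤Δ
    departure-next-level 1≤Δ (suc (suc d)) = departure-next-level 1≤Δ d

    departure-previous-level : 1 ≤ Δ → ∀ d {t} → Avail G Δ (levelLabel Δ (suc d)) t →
                               DepartureWithin ⌈ Δ /2⌉ (levelLabel Δ d) t
    departure-previous-level 1≤Δ zero          = departure-⌈Δ/2⌉→Δ 1≤Δ
    departure-previous-level 1≤Δ (suc zero)    = departure-Δ→⌈Δ/2⌉ 1≤Δ
    departure-previous-level 1≤Δ (suc (suc d)) = departure-previous-level 1≤Δ d

  module RootedTree (connected : Connected G) (acyclic : Acyclic G) (r : Fin n) where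

    depth : Fin n → ℕ
    depth a = proj₁ (connected r a)

    route : Fin n → List (Fin n)
    route a = inner (proj₁ (proj₂ (connected r a)))

    route-trail : ∀ a → Trail r (route a) a
    route-trail a = toTrail (proj₁ (proj₂ (connected r a)))

    route-unique : ∀ a → Unique (r ∷ route a)
    route-unique a = inner-unique (proj₂ (connected r a))

    route-canonical : ∀ {a xs} → Trail r xs a → Unique (r ∷ xs) → xs ≡ route a
    route-canonical t u = trail-unique acyclic t u (route-trail _) (route-unique _)

    length-route : ∀ a → length (route a) ≡ depth a
    length-route a = length-inner (proj₁ (proj₂ (connected r a)))

    depth-isDist : ∀ a → IsDist G r a (depth a)
    depth-isDist a = proj₂ (connected r a) , shortest
      where
        shortest : ∀ k → Path G r a k → depth a ≤ k
        shortest k (p , u) = ≤-reflexive (begin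
          depth a          ≡⟨ length-route a ⟨
          length (route a) ≡⟨ cong length (route-canonical (toTrail p) (inner-unique (p , u))) ⟨
          length (inner p) ≡⟨ length-inner p ⟩
          k                ∎)
          where open ≡-Reasoning

    -- x ⋖ y: x is the parent of y in the tree rooted at r.
    _⋖_ : Fin n → Fin n → Set
    x ⋖ y = route y ≡ route x ∷ʳ y

    ⋖-depth : ∀ {x y} → x ⋖ y → depth y ≡ suc (depth x)
    ⋖-depth {x} {y} x⋖y = begin
      depth y                 ≡⟨ length-route y ⟨
      length (route y)        ≡⟨ cong length x⋖y ⟩
      length (route x ∷ʳ y)   ≡⟨ length-++ (route x) ⟩
      length (route x) + 1    ≡⟨ +-comm (length (route x)) 1 ⟩
      suc (length (route x))  ≡⟨ cong suc (length-route x) ⟩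
      suc (depth x)           ∎
      where open ≡-Reasoning

    ⋖-parent-unique : ∀ {x y z} → x ⋖ y → z ⋖ y → x ≡ z
    ⋖-parent-unique {x} {y} {z} x⋖y z⋖y =
      end-unique (route-trail x) (subst (λ xs → Trail r xs z) (sym same-route) (route-trail z))
      where
        same-route : route x ≡ route z
        same-route = ∷ʳ-injectiveˡ (route x) (route z) (trans (sym x⋖y) z⋖y)

    adjacent-⋖ : ∀ {x y} → Adj x y → x ⋖ y ⊎ y ⋖ x
    adjacent-⋖ {x} {y} xy with y ∈? r ∷ route x
    ... | no y∉ = inj₁ (sym (route-canonical (route-trail x ++ᵗ (xy ∷ [])) route-x-y-unique))
      where
        route-x-y-unique : Unique (r ∷ route x ∷ʳ y)
        route-x-y-unique = ++⁺ (route-unique x) ([] ∷ []) λ { (y∈ , here refl) → y∉ y∈ }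
    ... | yes y∈ with splitAt (route-trail x) (route-unique x) y∈
    ...   | ys , zs , route-x , (s , us) , (t , ut) = inj₂ (begin
      route x      ≡⟨ route-x ⟩
      ys ++ zs     ≡⟨ cong₂ _++_ (route-canonical s us) zs≡[x] ⟩
      route y ∷ʳ x ∎)
      where
        open ≡-Reasoning
        zs≡[x] : zs ≡ [ x ]
        zs≡[x] = trail-unique acyclic t ut (Adj-sym xy ∷ [])
                              (((λ { refl → irrefl xy }) ∷ []) ∷ [] ∷ [])

    module Schedule (Δ : ℕ) (1≤Δ : 1 ≤ Δ) (lab : Fin n → Fin n → ℕ) (labeling : IsLabeling G Δ lab)
                    (lab-⋖ : ∀ {x y} → Adj x y → x ⋖ y → lab x y ≡ levelLabel Δ (depth y)) where
      open Timetable Δ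
      open DoubledTime Δ

      lab-⋗ : ∀ {x y} → Adj x y → y ⋖ x → lab x y ≡ levelLabel Δ (depth x)
      lab-⋗ xy y⋖x = trans (proj₁ (labeling xy)) (lab-⋖ (Adj-sym xy) y⋖x)

      departure-ascending : ∀ {x y z t} → Adj x y → Adj y z → x ⋖ y → y ⋖ z →
                            Avail G Δ (lab x y) t → DepartureWithin ⌈ Δ /2⌉ (lab y z) t
      departure-ascending {y = y} {t = t} xy yz x⋖y y⋖z av =
        subst (λ l → DepartureWithin ⌈ Δ /2⌉ l t)
              (sym (trans (lab-⋖ yz y⋖z) (cong (levelLabel Δ) (⋖-depth y⋖z))))
              (departure-next-level 1≤Δ (depth y) (subst (λ l → Avail G Δ l t) (lab-⋖ xy x⋖y) av))

      departure-descending : ∀ {x y z t} → Adj x y → Adj y z → y ⋖ x → z ⋖ y →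
                             Avail G Δ (lab x y) t → DepartureWithin ⌈ Δ /2⌉ (lab y z) t
      departure-descending {x} {y} {t = t} xy yz y⋖x z⋖y av =
        subst (λ l → DepartureWithin ⌈ Δ /2⌉ l t) (sym (lab-⋗ yz z⋖y))
              (departure-previous-level 1≤Δ (depth y) (subst (λ l → Avail G Δ l t) lab-xy av))
        where
          lab-xy : lab x y ≡ levelLabel Δ (suc (depth y))
          lab-xy = trans (lab-⋗ xy y⋖x) (cong (levelLabel Δ) (⋖-depth y⋖x))

      departure-any : ∀ {x y z t} → Adj x y → Adj y z →
                      Avail G Δ (lab x y) t → DepartureWithin Δ (lab y z) t
      departure-any xy yz with labeling xy | labeling yz
      ... | _ , _ , lab-xy≤Δ | _ , 1≤lab-yz , lab-yz≤Δ =
        departure-within-period lab-xy≤Δ 1≤lab-yz lab-yz≤Δ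

      TWalkAlong : ∀ {y v k} → Fin n → Walk G y v k → ℕ → ℕ → Set
      TWalkAlong {v = v} x w t tₖ =
        Σ (TWalk G Δ lab x v t tₖ) λ tw → twVerts G tw ≡ x ∷ walkVerts G w

      ascend : ∀ {x y v k t} (xy : Adj x y) → x ⋖ y → (w : Walk G y v k) →
               Unique (x ∷ walkVerts G w) → Avail G Δ (lab x y) t →
               ∃ λ tₖ → TWalkAlong x w t tₖ × 2 * tₖ ≤ 2 * t + k * suc Δ
      ascend xy x⋖y stop _ av = _ , (last xy av , refl) , m≤m+n _ 0
      ascend {t = t} xy x⋖y (step {k = k} yz w) (x∉ ∷ u) av with adjacent-⋖ yz
      ... | inj₂ z⋖y = ⊥-elim (All.lookup x∉ (there (start∈walkVerts w)) (⋖-parent-unique x⋖y z⋖y))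
      ... | inj₁ y⋖z with departure-ascending xy yz x⋖y y⋖z av
      ...   | t' , t<t' , av' , t'≤ with ascend yz y⋖z w u av'
      ...     | tₖ , (tw , verts) , bound =
                tₖ , (cons xy av t<t' tw , cong (_ ∷_) verts) , wait-≤-half-period t k t'≤ bound

      -- The bound carries an extra 2: the first edge is charged its full share (Δ+1)/2 but
      -- adds only 1 to the duration, and the remainder pays for a turn.
      descend : ∀ {x y v k t} (xy : Adj x y) → y ⋖ x → (w : Walk G y v k) →
                Unique (x ∷ walkVerts G w) → Avail G Δ (lab x y) t →
                ∃ λ tₖ → TWalkAlong x w t tₖ × 2 * tₖ + 2 ≤ 2 * t + suc k * suc Δ
      descend xy y⋖x stop _ av =
        _ , (last xy av , refl) , +-monoʳ-≤ _ (≤-trans (s≤s 1≤Δ) (m≤m+n _ 0))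
      descend {t = t} xy y⋖x (step {k = k} yz w) (_ ∷ u) av with adjacent-⋖ yz
      ... | inj₁ y⋖z with departure-any xy yz av
      ...   | t' , t<t' , av' , t'≤ with ascend yz y⋖z w u av'
      ...     | tₖ , (tw , verts) , bound =
                tₖ , (cons xy av t<t' tw , cong (_ ∷_) verts) , wait-≤-period t k t'≤ bound
      descend {t = t} xy y⋖x (step {k = k} yz w) (_ ∷ u) av | inj₂ z⋖y
        with departure-descending xy yz y⋖x z⋖y av
      ...   | t' , t<t' , av' , t'≤ with descend yz z⋖y w u av'
      ...     | tₖ , (tw , verts) , bound =
                tₖ , (cons xy av t<t' tw , cong (_ ∷_) verts) ,
                wait-≤-half-period t (suc k) t'≤ bound

      fast-temporal-path : ∀ {x y v k} (xy : Adj x y) (w : Walk G y v k) →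
                           Unique (x ∷ walkVerts G w) →
                           ∃ λ t₁ → ∃ λ tₖ → TPath G Δ lab x v t₁ tₖ ×
                                             2 * duration G t₁ tₖ ≤ (Δ + 1) * suc k
      fast-temporal-path {x} {y} {k = k} xy w u with adjacent-⋖ xy
      ... | inj₁ x⋖y with ascend xy x⋖y w u departs-at-label
      ...   | tₖ , (tw , verts) , bound =
                lab x y , tₖ , (tw , subst Unique (sym verts) u) ,
                doubled-duration k (departure≤arrival tw) (first-edge-slack (lab x y) k 1≤Δ bound)
      fast-temporal-path {x} {y} {k = k} xy w u | inj₂ y⋖x with descend xy y⋖x w u departs-at-label
      ...   | tₖ , (tw , verts) , bound =
                lab x y , tₖ , (tw , subst Unique (sym verts) u) ,
                doubled-duration k (departure≤arrival tw) bound

mainTheorem4 : (G : Graph) → IsTree G → (Δ : ℕ) → (lab : Fin (Graph.n G) → Fin (Graph.n G) → ℕ) →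
    RadiusAlgorithmLabeling G Δ lab → StretchAtMostHalfΔ+1 G Δ lab
mainTheorem4 G _ Δ lab _ u v u≢v _ ((stop , _) , _) = ⊥-elim (u≢v refl)
mainTheorem4 G (connected , acyclic) Δ lab (labeling , vx , rad , _ , ecc , rule) u v _ _
             ((step uy w , unique) , _) =
  fast-temporal-path uy w unique
  where
    open Graph G using (Adj)
    open RootedTree G connected acyclic vx

    lab-⋖ : ∀ {x y} → Adj x y → x ⋖ y → lab x y ≡ levelLabel Δ (depth y)
    lab-⋖ {x} {y} xy x⋖y =
      trans (levelLabel-by-parity Δ (suc (depth x)) (rule x y (depth x) xy dist-x dist-y y≤rad))
            (cong (levelLabel Δ) (sym (⋖-depth x⋖y)))
      where
        dist-x : IsDist G vx x (depth x)
        dist-x = depth-isDist x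
        dist-y : IsDist G vx y (suc (depth x))
        dist-y = subst (IsDist G vx y) (⋖-depth x⋖y) (depth-isDist y)
        y≤rad : suc (depth x) ≤ rad
        y≤rad = proj₁ ecc y _ dist-y

    1≤Δ : 1 ≤ Δ
    1≤Δ = ≤-trans (proj₁ (proj₂ (labeling uy))) (proj₂ (proj₂ (labeling uy)))

    open Schedule Δ 1≤Δ lab labeling lab-⋖
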